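{- Every P-graph contains no theta, no wheel and no diamond as an induced subgraph.
   Context: All graphs are finite and simple. A hole is a chordless cycle of length at least 4. A theta is a graph made of three internally vertex-disjoint chordless paths between two vertices $a,b$, each of length at least 2, with no edges between the paths except the three edges incident to $a$ and the three edges incident to $b$. A wheel is a hole $H$ together with a vertex not in $H$ having at least three neighbors in $H$. A diamond is the graph obtained from a clique on 4 vertices by deleting one edge. A graph is chordless if no cycle of it has a chord; $L(R)$ is the line graph of $R$. Skeletons: in a graph $R$, a branch vertex is a vertex of degree at least 3; an edge is pendant if at least one endnode has degree 1. A branch is a path of length at least 1 whose internal vertices have degree 2 in $R$ and whose two endnodes are branch vertices; a limb is a path of length at least 1 whose internal vertices have degree 2 in $R$, with one endnode of degree at least 3 and the other of degree 1. Two distinct branches are parallel if they have the same endnodes; two distinct limbs are parallel if they share their endnode of degree at least 3. An attaching vertex is a cut vertex of degree at least 3. For an attaching vertex $x$, let $C_1,\dots,C_t$ be the components of $R-x$ that together with $x$ do not form limbs of $R$; the $x$-petals of $R$ are the graphs $R[V(C_i)\cup\{x\}]$ and, if $x$ is the end of at least two parallel limbs, also the subgraph formed by all limbs of $R$ with endnode $x$. For an integer $k\ge 1$, a $k$-skeleton is a graph $R$ such that: (i) $R$ is connected, triangle-free, chordless and has at least three pendant edges; (ii) $R$ has no parallel branches; (iii) for every cut vertex $u$, every component of $R-u$ has a vertex of degree 1 in $R$; (iv) for every vertex cutset $S=\{a,b\}$ and every component $C$ of $R\setminus S$, either $R[C\cup S]$ is a chordless path from $a$ to $b$ or $C$ contains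 a vertex of degree 1 in $R$; (v) for every edge of a cycle of $R$, at least one endnode has degree 2; (vi) each pendant edge gets one label from $\{1,\dots,k\}$; (vii) every label is used at least once and some label is used at least twice; (viii) if a pendant edge with an endnode of degree at least 3 gets label $i$, then no other pendant edge gets label $i$; (ix) if $R$ has no branches then $k=1$, and otherwise, whenever two limbs are parallel, their pendant edges get different labels and at least one of these labels is used more than once; (x) if $k>1$, then for every attaching vertex $x$ and every $x$-petal $H$, at least two distinct labels are used on pendant edges of $H$, and if $\overline H$ is a union of at least one but not all $x$-petals, some label $i$ is used on pendant edges of both $\overline H$ and $(R\setminus\overline H)\cup\{x\}$; (xi) if $k=2$ then both labels are used at least twice. A P-graph is a graph $B$ obtained by taking $k\ge1$ and a $k$-skeleton $R$, forming $L(R)$ where each vertex corresponding to a pendant edge of $R$ (a pendant vertex) gets the label of that edge, adding a clique $K=\{v_1,\dots,v_k\}$ disjoint from $L(R)$, and joining $v_i$ to all pendant vertices of label $i$, for $i=1,\dots,k$. -}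

module Defs where

open import Data.Nat using (ℕ; zero; suc; _≤_; _<_; _<ᵇ_)
open import Data.Fin using (Fin; toℕ; fromℕ)
open import Data.Fin.Subset as S using (Subset; _∈_; ⁅_⁆; ∁; _∪_; ⋃; Nonempty; ∣_∣)
open import Data.Vec using (tabulate)
open import Data.Bool using (Bool; true; false; T)
open import Data.List using (List; []; _∷_; _++_; [_]; reverse; length; lookup)
open import Data.List.Relation.Unary.All using (All)
open import Data.List.Relation.Unary.Unique.Propositional using (Unique)
open import Data.List.Relation.Unary.Linked using (Linked)
import Data.List.Membership.Propositional as LM
open import Data.Product using (Σ; ∃; ∃-syntax; _×_; _,_)
open import Data.Sum using (_⊎_; inj₁; inj₂)
open import Relation.Nullary using (¬_)
open import Data.Empty using (⊥)
open import Relation.Binary.PropositionalEquality using (_≡_; _≢_)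
open import Function.Definitions using (Injective)
open import Function.Bundles using (_⇔_)

Consec : ∀ {m} → Fin m → Fin m → Set
Consec i j = suc (toℕ i) ≡ toℕ j ⊎ suc (toℕ j) ≡ toℕ i

CycConsec : (ℓ : ℕ) → Fin ℓ → Fin ℓ → Set
CycConsec ℓ i j =
  Consec i j ⊎ ((toℕ i ≡ 0 × suc (toℕ j) ≡ ℓ) ⊎ (toℕ j ≡ 0 × suc (toℕ i) ≡ ℓ))

Internal : ∀ m → Fin (suc m) → Set
Internal m i = 0 < toℕ i × toℕ i < m

module Induced {V : Set} (_~_ : V → V → Set) where

  ChordlessPath : ∀ m → (Fin (suc m) → V) → Set
  ChordlessPath m p =
    Injective _≡_ _≡_ p × (∀ i j → (p i ~ p j) ⇔ Consec i j)

  Separated : ∀ {m m'} → (Fin (suc m) → V) → (Fin (suc m') → V) → Set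
  Separated {m} {m'} p q =
    ∀ i j → Internal m i → Internal m' j → p i ≢ q j × ¬ (p i ~ q j)

  HasTheta : Set
  HasTheta =
    Σ V λ a → Σ V λ b →
    Σ ℕ λ m₁ → Σ ℕ λ m₂ → Σ ℕ λ m₃ →
    Σ (Fin (suc m₁) → V) λ p₁ →
    Σ (Fin (suc m₂) → V) λ p₂ →
    Σ (Fin (suc m₃) → V) λ p₃ →
      (2 ≤ m₁ × 2 ≤ m₂ × 2 ≤ m₃)
    × (ChordlessPath m₁ p₁ × ChordlessPath m₂ p₂ × ChordlessPath m₃ p₃)
    × (p₁ Fin.zero ≡ a × p₂ Fin.zero ≡ a × p₃ Fin.zero ≡ a)
    × (p₁ (fromℕ m₁) ≡ b × p₂ (fromℕ m₂) ≡ b × p₃ (fromℕ m₃) ≡ b)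
    × (Separated p₁ p₂ × Separated p₁ p₃ × Separated p₂ p₃)

  IsHole : ∀ ℓ → (Fin ℓ → V) → Set
  IsHole ℓ h =
    4 ≤ ℓ × Injective _≡_ _≡_ h × (∀ i j → (h i ~ h j) ⇔ CycConsec ℓ i j)

  HasWheel : Set
  HasWheel =
    Σ ℕ λ ℓ → Σ (Fin ℓ → V) λ h → Σ V λ v →
      IsHole ℓ h × (∀ i → h i ≢ v)
    × Σ (Fin ℓ) λ i₁ → Σ (Fin ℓ) λ i₂ → Σ (Fin ℓ) λ i₃ →
        (i₁ ≢ i₂ × i₁ ≢ i₃ × i₂ ≢ i₃)
      × (v ~ h i₁ × v ~ h i₂ × v ~ h i₃)

  HasDiamond : Set
  HasDiamond =
    Σ V λ a → Σ V λ b → Σ V λ c → Σ V λ d →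
      (a ≢ b × a ≢ c × a ≢ d × b ≢ c × b ≢ d × c ≢ d)
    × (a ~ b × a ~ c × a ~ d × b ~ c × b ~ d × ¬ (c ~ d))

record Graph : Set where
  field
    n         : ℕ
    adj       : Fin n → Fin n → Bool
    adj-sym   : ∀ u v → adj u v ≡ adj v u
    adj-irrefl : ∀ u → adj u u ≡ false

module GraphNotions (R : Graph) where
  open Graph R public
  open LM using () renaming (_∈_ to _∈L_)

  Adj : Fin n → Fin n → Set
  Adj u v = adj u v ≡ true

  Vertex : Set
  Vertex = Fin n

  N : Fin n → Subset n
  N u = tabulate (adj u)

  deg : Fin n → ℕ
  deg u = ∣ N u ∣

  -- an edge {src , tgt}, stored with src < tgt (so each edge occurs once)
  record Edge : Set where
    constructor edge
    field
      src     : Fin n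
      tgt     : Fin n
      isEdge  : T (adj src tgt)
      ordered : T (toℕ src <ᵇ toℕ tgt)
  open Edge public

  _∈ₑ_ : Fin n → Edge → Set
  v ∈ₑ e = v ≡ src e ⊎ v ≡ tgt e

  SharesEnd : Edge → Edge → Set
  SharesEnd e f = src e ∈ₑ f ⊎ tgt e ∈ₑ f

  Pendant : Edge → Set
  Pendant e = deg (src e) ≡ 1 ⊎ deg (tgt e) ≡ 1

  -- reachability inside the vertex set X (induced subgraph R[X])
  data Reach (X : Subset n) : Fin n → Fin n → Set where
    here : ∀ {u} → u ∈ X → Reach X u u
    step : ∀ {u w v} → u ∈ X → Adj u w → Reach X w v → Reach X u v

  Connected : Set
  Connected = ∀ u v → Reach S.⊤ u v

  -- C is (the vertex set of) a connected component of R[X]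
  Component : Subset n → Subset n → Set
  Component X C =
    Nonempty C × (∀ u → u ∈ C → ∀ v → (v ∈ C → Reach X u v) × (Reach X u v → v ∈ C))

  -- u is a cut vertex: its removal increases the number of components
  CutVertex : Fin n → Set
  CutVertex u = Σ (Fin n) λ v → Σ (Fin n) λ w →
    v ≢ u × w ≢ u × Reach S.⊤ v w × ¬ Reach (∁ ⁅ u ⁆) v w

  TwoCutset : Fin n → Fin n → Set
  TwoCutset a b = a ≢ b × Σ (Fin n) λ v → Σ (Fin n) λ w →
    v ∈ ∁ (⁅ a ⁆ ∪ ⁅ b ⁆) × w ∈ ∁ (⁅ a ⁆ ∪ ⁅ b ⁆) × ¬ Reach (∁ (⁅ a ⁆ ∪ ⁅ b ⁆)) v w

  TriangleFree : Set
  TriangleFree = ∀ u v w → Adj u v → Adj v w → Adj u w → ⊥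

  IsCycle : ∀ ℓ → (Fin ℓ → Fin n) → Set
  IsCycle ℓ c = 3 ≤ ℓ × Injective _≡_ _≡_ c × (∀ i j → CycConsec ℓ i j → Adj (c i) (c j))

  HasChord : ∀ ℓ → (Fin ℓ → Fin n) → Set
  HasChord ℓ c = Σ (Fin ℓ) λ i → Σ (Fin ℓ) λ j →
    i ≢ j × ¬ CycConsec ℓ i j × Adj (c i) (c j)

  ChordlessGraph : Set
  ChordlessGraph = ∀ ℓ c → IsCycle ℓ c → ¬ HasChord ℓ c

  IsPath : List (Fin n) → Set
  IsPath ps = Unique ps × Linked Adj ps

  IsChordlessPathL : List (Fin n) → Set
  IsChordlessPathL ps =
    Unique ps × (∀ i j → Adj (lookup ps i) (lookup ps j) ⇔ Consec i j)

  seg : Fin n → List (Fin n) → Fin n → List (Fin n)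
  seg a is b = a ∷ is ++ [ b ]

  IsBranch : Fin n → List (Fin n) → Fin n → Set
  IsBranch a is b = IsPath (seg a is b) × All (λ v → deg v ≡ 2) is × 3 ≤ deg a × 3 ≤ deg b

  IsLimb : Fin n → List (Fin n) → Fin n → Set
  IsLimb a is b = IsPath (seg a is b) × All (λ v → deg v ≡ 2) is × 3 ≤ deg a × deg b ≡ 1

  HasBranch : Set
  HasBranch = Σ (Fin n) λ a → Σ (List (Fin n)) λ is → Σ (Fin n) λ b → IsBranch a is b

  NoParallelBranches : Set
  NoParallelBranches = ∀ a is b a' is' b' → IsBranch a is b → IsBranch a' is' b' →
    ((a ≡ a' × b ≡ b') ⊎ (a ≡ b' × b ≡ a')) →
    seg a is b ≡ seg a' is' b' ⊎ seg a is b ≡ reverse (seg a' is' b')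

  ParallelLimbs : Fin n → List (Fin n) → Fin n → List (Fin n) → Fin n → Set
  ParallelLimbs x is b is' b' = IsLimb x is b × IsLimb x is' b' × (is , b) ≢ (is' , b')

  AttachingVertex : Fin n → Set
  AttachingVertex x = CutVertex x × 3 ≤ deg x

  -- x-petals, as vertex sets (they are induced subgraphs of R)
  Petal : Fin n → Subset n → Set
  Petal x P =
    (Σ (Subset n) λ C → Component (∁ ⁅ x ⁆) C
       × ¬ (Σ (Fin n) λ a → Σ (List (Fin n)) λ is → Σ (Fin n) λ b →
              IsLimb a is b × (∀ v → (v ∈ (C ∪ ⁅ x ⁆)) ⇔ (v ∈L seg a is b)))
       × P ≡ C ∪ ⁅ x ⁆)
    ⊎ ((Σ (List (Fin n)) λ is → Σ (Fin n) λ b → Σ (List (Fin n)) λ is' → Σ (Fin n) λ b' →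
          ParallelLimbs x is b is' b')
       × (∀ v → (v ∈ P) ⇔ (Σ (List (Fin n)) λ is → Σ (Fin n) λ b →
                              IsLimb x is b × v ∈L seg x is b)))

module Labelled (R : Graph) (k : ℕ) (lab : GraphNotions.Edge R → Fin k) where
  open GraphNotions R

  Used : Fin k → Set
  Used i = Σ Edge λ e → Pendant e × lab e ≡ i

  UsedTwice : Fin k → Set
  UsedTwice i = Σ Edge λ e → Σ Edge λ e' →
    e ≢ e' × Pendant e × Pendant e' × lab e ≡ i × lab e' ≡ i

  UsedIn : Subset n → Fin k → Set
  UsedIn X i = Σ Edge λ e → Pendant e × src e ∈ X × tgt e ∈ X × lab e ≡ i

  IsSkeleton : Set
  IsSkeleton =
      1 ≤ k
    -- (i)
    × Connected × TriangleFree × ChordlessGraph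
    × (Σ Edge λ e₁ → Σ Edge λ e₂ → Σ Edge λ e₃ →
         e₁ ≢ e₂ × e₁ ≢ e₃ × e₂ ≢ e₃ × Pendant e₁ × Pendant e₂ × Pendant e₃)
    -- (ii)
    × NoParallelBranches
    -- (iii)
    × (∀ u → CutVertex u → ∀ C → Component (∁ ⁅ u ⁆) C →
         Σ (Fin n) λ v → v ∈ C × deg v ≡ 1)
    -- (iv)
    × (∀ a b → TwoCutset a b → ∀ C → Component (∁ (⁅ a ⁆ ∪ ⁅ b ⁆)) C →
         (Σ (List (Fin n)) λ is → IsChordlessPathL (seg a is b)
              × (∀ v → (v ∈ (C ∪ (⁅ a ⁆ ∪ ⁅ b ⁆))) ⇔ (v LM.∈ seg a is b)))
         ⊎ (Σ (Fin n) λ v → v ∈ C × deg v ≡ 1))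
    -- (v)
    × (∀ ℓ c i j → IsCycle ℓ c → CycConsec ℓ i j → deg (c i) ≡ 2 ⊎ deg (c j) ≡ 2)
    -- (vi) is the datum lab (only its values on pendant edges matter)
    -- (vii)
    × (∀ i → Used i) × (Σ (Fin k) λ i → UsedTwice i)
    -- (viii)
    × (∀ e → Pendant e → (3 ≤ deg (src e) ⊎ 3 ≤ deg (tgt e)) →
         ∀ e' → Pendant e' → e' ≢ e → lab e' ≢ lab e)
    -- (ix)
    × (¬ HasBranch → k ≡ 1)
    × (HasBranch → ∀ x is b is' b' → ParallelLimbs x is b is' b' →
         ∀ e e' → b ∈ₑ e → b' ∈ₑ e' →
         lab e ≢ lab e' × (UsedTwice (lab e) ⊎ UsedTwice (lab e')))
    -- (x)
    × (1 < k → ∀ x → AttachingVertex x →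
         (∀ P → Petal x P →
            Σ (Fin k) λ i → Σ (Fin k) λ j → i ≢ j × UsedIn P i × UsedIn P j)
       × (∀ (Ps : List (Subset n)) → All (Petal x) Ps → Ps ≢ [] →
            (Σ (Subset n) λ P → Petal x P × ¬ (P LM.∈ Ps)) →
            Σ (Fin k) λ i → UsedIn (⋃ Ps) i × UsedIn (∁ (⋃ Ps) ∪ ⁅ x ⁆) i))
    -- (xi)
    × (k ≡ 2 → ∀ i → UsedTwice i)

  -- adjacency of the P-graph B built from (R , lab): vertices are the
  -- edges of R (vertices of L(R)) and the clique vertices v₁ … v_k
  PVertex : Set
  PVertex = Edge ⊎ Fin k

  PAdj : PVertex → PVertex → Set
  PAdj (inj₁ e) (inj₁ f) = e ≢ f × SharesEnd e f
  PAdj (inj₁ e) (inj₂ i) = Pendant e × lab e ≡ i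
  PAdj (inj₂ i) (inj₁ e) = Pendant e × lab e ≡ i
  PAdj (inj₂ i) (inj₂ j) = i ≢ j

-- An edge-vertex of L(R) is never the centre of a claw in B: its edge-neighbours meet it at one of its two
-- ends, and if it also has a clique neighbour then it is pendant and they all meet it at its stem. The two
-- ends of a theta are claw centres, hence clique vertices, hence adjacent, so there is no theta. Diamonds
-- are excluded case by case, using that R is triangle-free and (viii).
-- For a wheel, a pendant edge on a hole always has its clique vertex on the hole too, so a clique centre
-- would see only clique vertices of the hole, i.e. a triangle. For a wheel centred at an edge e = xy of R,
-- at most one spoke is a clique vertex, and if there is one then (viii) is violated. Three edge spokes
-- through one end of e would form a triangle in the hole, so two spokes A, B meet e at an end x and a
-- third spoke C at the other end y. Then x and y have degree at least 3, and going round the hole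
-- from B to C or from C to A avoids the (at most two, consecutive) clique vertices of the hole, which gives
-- a path of R − e between y and x: together with e this is a cycle contradicting (v).
module Submission where

open import Defs
open import Data.Nat using (ℕ; zero; suc; _+_; _∸_; _≤_; _<_; _%_; s≤s; z≤n)
open import Data.Nat.Properties
  using ( _≟_; suc-injective; +-suc; +-comm; +-assoc; +-identityʳ; m+[n∸m]≡n; m∸n+n≡m
        ; ≤-refl; ≤-trans; <-trans; ≤-<-trans; <⇒≤; <⇒≢; ≤∧≢⇒<; <-irrefl; <-asym; <⇒≤pred
        ; n<1+n; n≤1+n; m≤m+n; n≮0; <ᵇ⇒< )
open import Data.Nat.DivMod using (_mod_; %-distribˡ-+; m%n%n≡m%n; n%n≡0; m<n⇒m%n≡m; [m+n]%n≡m%n)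
open import Data.Fin using (Fin; toℕ; fromℕ; fromℕ<; inject₁) renaming (zero to fzero; suc to fsuc)
import Data.Fin.Properties as Fin
open import Data.Fin.Properties using (toℕ-injective; toℕ<n; toℕ-fromℕ<; toℕ-fromℕ; toℕ-inject₁)
open import Data.Fin.Subset using (Subset; _∈_; ∣_∣)
open import Data.Fin.Subset.Properties using (x∈p∧x≢y⇒x∈p-y; x∈p⇒∣p-x∣<∣p∣)
open import Data.Vec using (tabulate)
open import Data.Vec.Properties using (lookup⇒[]=; lookup∘tabulate)
open import Data.Bool.Properties using (T-irrelevant; T-≡)
open import Data.List using (List; []; _∷_; length; lookup)
open import Data.List.Membership.Propositional.Properties using (∈-lookup)
open import Data.List.Relation.Unary.All as All using (All; []; _∷_)
open import Data.List.Relation.Unary.All.Properties.Core using (¬Any⇒All¬)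
open import Data.List.Relation.Unary.AllPairs using ([]; _∷_)
open import Data.List.Relation.Unary.Any as Any using (Any; here; there)
open import Data.List.Relation.Unary.Linked using (Linked; []; [-]; _∷_)
open import Data.List.Relation.Unary.Unique.Propositional using (Unique)
open import Data.Empty using (⊥; ⊥-elim)
open import Data.Product using (Σ; _×_; _,_; proj₁; proj₂)
open import Data.Sum using (_⊎_; inj₁; inj₂)
import Data.Sum as Sum
open import Data.Sum.Properties using (inj₁-injective)
open import Relation.Nullary using (¬_; yes; no)
open import Relation.Binary.Definitions using (DecidableEquality)
import Relation.Binary.Construct.Closure.ReflexiveTransitive as Star
open import Relation.Binary.Construct.Closure.ReflexiveTransitive using (Star; ε; _◅_; _◅◅_)
open import Relation.Binary.PropositionalEquality
  using (_≡_; _≢_; refl; sym; trans; cong; subst; subst₂; module ≡-Reasoning)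
open import Function.Bundles using (_⇔_; mk⇔; Equivalence)
open import Function.Definitions using (Injective)
open import Function.Base using (_∘_)

module CyclicPositions {m : ℕ} where
  open ≡-Reasoning

  private
    ℓ : ℕ
    ℓ = suc m

  CycSucc : Fin ℓ → Fin ℓ → Set
  CycSucc i j = suc (toℕ i) % ℓ ≡ toℕ j

  succ⇒ : ∀ {i j} → CycSucc i j → suc (toℕ i) ≡ toℕ j ⊎ (toℕ j ≡ 0 × suc (toℕ i) ≡ ℓ)
  succ⇒ {i} {j} s with suc (toℕ i) ≟ ℓ
  ... | yes wraps = inj₂ (trans (sym s) (trans (cong (_% ℓ) wraps) (n%n≡0 ℓ)) , wraps)
  ... | no ¬wraps = inj₁ (trans (sym (m<n⇒m%n≡m (≤∧≢⇒< (toℕ<n i) ¬wraps))) s)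

  succ⇐ : ∀ {i j} → suc (toℕ i) ≡ toℕ j ⊎ (toℕ j ≡ 0 × suc (toℕ i) ≡ ℓ) → CycSucc i j
  succ⇐ {i} {j} (inj₁ e) = trans (m<n⇒m%n≡m (subst (_< ℓ) (sym e) (toℕ<n j))) e
  succ⇐ {i} {j} (inj₂ (j≡0 , wraps)) = trans (cong (_% ℓ) wraps) (trans (n%n≡0 ℓ) (sym j≡0))

  cycConsec⇔succ : ∀ {i j} → CycConsec ℓ i j ⇔ (CycSucc i j ⊎ CycSucc j i)
  cycConsec⇔succ = mk⇔ to from
    where
    to : ∀ {i j} → CycConsec ℓ i j → CycSucc i j ⊎ CycSucc j i
    to (inj₁ (inj₁ e)) = inj₁ (succ⇐ (inj₁ e))
    to (inj₁ (inj₂ e)) = inj₂ (succ⇐ (inj₁ e))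
    to (inj₂ (inj₁ w)) = inj₂ (succ⇐ (inj₂ w))
    to (inj₂ (inj₂ w)) = inj₁ (succ⇐ (inj₂ w))
    from : ∀ {i j} → CycSucc i j ⊎ CycSucc j i → CycConsec ℓ i j
    from (inj₁ s) = Sum.map inj₁ inj₂ (succ⇒ s)
    from (inj₂ s) = Sum.map inj₂ inj₁ (succ⇒ s)

  cycConsec-sym : ∀ {i j} → CycConsec ℓ i j → CycConsec ℓ j i
  cycConsec-sym = Sum.map Sum.swap Sum.swap

  %-absorbˡ : ∀ a b → (a % ℓ + b) % ℓ ≡ (a + b) % ℓ
  %-absorbˡ a b = begin
    (a % ℓ + b) % ℓ         ≡⟨ %-distribˡ-+ (a % ℓ) b ℓ ⟩
    (a % ℓ % ℓ + b % ℓ) % ℓ ≡⟨ cong (λ r → (r + b % ℓ) % ℓ) (m%n%n≡m%n a ℓ) ⟩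
    (a % ℓ + b % ℓ) % ℓ     ≡⟨ %-distribˡ-+ a b ℓ ⟨
    (a + b) % ℓ             ∎

  %-absorbʳ : ∀ a b → (a + b % ℓ) % ℓ ≡ (a + b) % ℓ
  %-absorbʳ a b = begin
    (a + b % ℓ) % ℓ ≡⟨ cong (_% ℓ) (+-comm a (b % ℓ)) ⟩
    (b % ℓ + a) % ℓ ≡⟨ %-absorbˡ b a ⟩
    (b + a) % ℓ     ≡⟨ cong (_% ℓ) (+-comm b a) ⟩
    (a + b) % ℓ     ∎

  rotate : ℕ → Fin ℓ → Fin ℓ
  rotate s i = (toℕ i + s) mod ℓ

  toℕ-rotate : ∀ s i → toℕ (rotate s i) ≡ (toℕ i + s) % ℓ
  toℕ-rotate s i = toℕ-fromℕ< _

  rotate-rotate : ∀ s t i → rotate t (rotate s i) ≡ rotate (s + t) i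
  rotate-rotate s t i = toℕ-injective (begin
    toℕ (rotate t (rotate s i)) ≡⟨ toℕ-rotate t (rotate s i) ⟩
    (toℕ (rotate s i) + t) % ℓ  ≡⟨ cong (λ r → (r + t) % ℓ) (toℕ-rotate s i) ⟩
    ((toℕ i + s) % ℓ + t) % ℓ   ≡⟨ %-absorbˡ (toℕ i + s) t ⟩
    (toℕ i + s + t) % ℓ         ≡⟨ cong (_% ℓ) (+-assoc (toℕ i) s t) ⟩
    (toℕ i + (s + t)) % ℓ       ≡⟨ toℕ-rotate (s + t) i ⟨
    toℕ (rotate (s + t) i)      ∎)

  rotate-full : ∀ i → rotate ℓ i ≡ i
  rotate-full i = toℕ-injective (begin
    toℕ (rotate ℓ i)  ≡⟨ toℕ-rotate ℓ i ⟩
    (toℕ i + ℓ) % ℓ   ≡⟨ [m+n]%n≡m%n (toℕ i) ℓ ⟩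
    toℕ i % ℓ         ≡⟨ m<n⇒m%n≡m (toℕ<n i) ⟩
    toℕ i             ∎)

  rotate-zero : ∀ p → rotate (toℕ p) fzero ≡ p
  rotate-zero p = toℕ-injective (trans (toℕ-rotate (toℕ p) fzero) (m<n⇒m%n≡m (toℕ<n p)))

  unrotate : Fin ℓ → Fin ℓ → Fin ℓ
  unrotate p = rotate (ℓ ∸ toℕ p)

  unrotate-rotate : ∀ p i → unrotate p (rotate (toℕ p) i) ≡ i
  unrotate-rotate p i = trans (rotate-rotate (toℕ p) (ℓ ∸ toℕ p) i)
    (trans (cong (λ s → rotate s i) (m+[n∸m]≡n (<⇒≤ (toℕ<n p)))) (rotate-full i))

  rotate-unrotate : ∀ p i → rotate (toℕ p) (unrotate p i) ≡ i
  rotate-unrotate p i = trans (rotate-rotate (ℓ ∸ toℕ p) (toℕ p) i)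
    (trans (cong (λ s → rotate s i) (m∸n+n≡m (<⇒≤ (toℕ<n p)))) (rotate-full i))

  unrotate-self : ∀ p → unrotate p p ≡ fzero
  unrotate-self p = trans (cong (unrotate p) (sym (rotate-zero p))) (unrotate-rotate p fzero)

  succ-rotate : ∀ s {i j} → CycSucc i j → CycSucc (rotate s i) (rotate s j)
  succ-rotate s {i} {j} i→j = begin
    suc (toℕ (rotate s i)) % ℓ  ≡⟨ cong (λ r → suc r % ℓ) (toℕ-rotate s i) ⟩
    (1 + (toℕ i + s) % ℓ) % ℓ   ≡⟨ %-absorbʳ 1 (toℕ i + s) ⟩
    (suc (toℕ i) + s) % ℓ       ≡⟨ %-absorbˡ (suc (toℕ i)) s ⟨
    (suc (toℕ i) % ℓ + s) % ℓ   ≡⟨ cong (λ r → (r + s) % ℓ) i→j ⟩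
    (toℕ j + s) % ℓ             ≡⟨ toℕ-rotate s j ⟨
    toℕ (rotate s j)            ∎

  cycConsec-rotate : ∀ s {i j} → CycConsec ℓ i j → CycConsec ℓ (rotate s i) (rotate s j)
  cycConsec-rotate s c = Equivalence.from cycConsec⇔succ
    (Sum.map (succ-rotate s) (succ-rotate s) (Equivalence.to cycConsec⇔succ c))

  rotate-last : ∀ {i j} → CycSucc i j → rotate (toℕ j) (fromℕ m) ≡ i
  rotate-last {i} {j} i→j = toℕ-injective (begin
    toℕ (rotate (toℕ j) (fromℕ m))   ≡⟨ toℕ-rotate (toℕ j) (fromℕ m) ⟩
    (toℕ (fromℕ m) + toℕ j) % ℓ      ≡⟨ cong (λ r → (r + toℕ j) % ℓ) (toℕ-fromℕ m) ⟩
    (m + toℕ j) % ℓ                  ≡⟨ cong (λ r → (m + r) % ℓ) i→j ⟨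
    (m + suc (toℕ i) % ℓ) % ℓ        ≡⟨ %-absorbʳ m (suc (toℕ i)) ⟩
    (m + suc (toℕ i)) % ℓ            ≡⟨ cong (_% ℓ) (trans (+-suc m (toℕ i)) (+-comm ℓ (toℕ i))) ⟩
    (toℕ i + ℓ) % ℓ                  ≡⟨ [m+n]%n≡m%n (toℕ i) ℓ ⟩
    toℕ i % ℓ                        ≡⟨ m<n⇒m%n≡m (toℕ<n i) ⟩
    toℕ i                            ∎)

  rotate-injective : ∀ p → Injective _≡_ _≡_ (rotate (toℕ p))
  rotate-injective p {i} {j} e =
    trans (sym (unrotate-rotate p i)) (trans (cong (unrotate p) e) (unrotate-rotate p j))

  unrotate-injective : ∀ p → Injective _≡_ _≡_ (unrotate p)
  unrotate-injective p {i} {j} e =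
    trans (sym (rotate-unrotate p i)) (trans (cong (rotate (toℕ p)) e) (rotate-unrotate p j))

  cycConsec-unrotate : ∀ p {i j} → CycConsec ℓ (rotate (toℕ p) i) (rotate (toℕ p) j) → CycConsec ℓ i j
  cycConsec-unrotate p {i} {j} c =
    subst₂ (CycConsec ℓ) (unrotate-rotate p i) (unrotate-rotate p j) (cycConsec-rotate (ℓ ∸ toℕ p) c)

  cycConsec-zero : ∀ {r} → CycConsec ℓ fzero r → toℕ r ≡ 1 ⊎ toℕ r ≡ m
  cycConsec-zero (inj₁ (inj₁ e))         = inj₁ (sym e)
  cycConsec-zero (inj₂ (inj₁ (_ , e)))   = inj₂ (suc-injective e)
  cycConsec-zero (inj₂ (inj₂ (r≡0 , e))) = inj₂ (trans r≡0 (suc-injective e))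

  ¬cycConsec-one-last : 4 ≤ ℓ → ∀ {a b} → toℕ a ≡ 1 → toℕ b ≡ m → ¬ CycConsec ℓ a b
  ¬cycConsec-one-last (s≤s (s≤s (s≤s (s≤s _)))) a≡1 b≡m (inj₁ (inj₁ e))
    with trans (cong suc (sym a≡1)) (trans e b≡m)
  ... | ()
  ¬cycConsec-one-last (s≤s (s≤s (s≤s (s≤s _)))) a≡1 b≡m (inj₁ (inj₂ e))
    with trans (cong suc (sym b≡m)) (trans e a≡1)
  ... | ()
  ¬cycConsec-one-last (s≤s (s≤s (s≤s (s≤s _)))) a≡1 b≡m (inj₂ (inj₁ (a≡0 , _)))
    with trans (sym a≡1) a≡0
  ... | ()
  ¬cycConsec-one-last (s≤s (s≤s (s≤s (s≤s _)))) a≡1 b≡m (inj₂ (inj₂ (b≡0 , _)))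
    with trans (sym b≡m) b≡0
  ... | ()

  cycConsec-noTriangle : 4 ≤ ℓ → ∀ {a b c} → b ≢ c →
                         CycConsec ℓ a b → CycConsec ℓ a c → ¬ CycConsec ℓ b c
  cycConsec-noTriangle 4≤ℓ {a} {b} {c} b≢c ab ac bc =
    atZero (cycConsec-zero (fromZero ab)) (cycConsec-zero (fromZero ac)) (cycConsec-rotate (ℓ ∸ toℕ a) bc)
    where
    fromZero : ∀ {r} → CycConsec ℓ a r → CycConsec ℓ fzero (unrotate a r)
    fromZero {r} ar =
      subst (λ z → CycConsec ℓ z (unrotate a r)) (unrotate-self a) (cycConsec-rotate (ℓ ∸ toℕ a) ar)
    b′ c′ : Fin ℓ
    b′ = unrotate a b
    c′ = unrotate a c
    b′≢c′ : toℕ b′ ≢ toℕ c′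
    b′≢c′ e = b≢c (unrotate-injective a (toℕ-injective e))
    atZero : toℕ b′ ≡ 1 ⊎ toℕ b′ ≡ m → toℕ c′ ≡ 1 ⊎ toℕ c′ ≡ m → ¬ CycConsec ℓ b′ c′
    atZero (inj₁ b≡1) (inj₁ c≡1) _ = b′≢c′ (trans b≡1 (sym c≡1))
    atZero (inj₂ b≡m) (inj₂ c≡m) _ = b′≢c′ (trans b≡m (sym c≡m))
    atZero (inj₁ b≡1) (inj₂ c≡m)   = ¬cycConsec-one-last 4≤ℓ b≡1 c≡m
    atZero (inj₂ b≡m) (inj₁ c≡1)   = ¬cycConsec-one-last 4≤ℓ c≡1 b≡m ∘ cycConsec-sym

  cycConsec-twoNeighbours : 4 ≤ ℓ → ∀ p → Σ (Fin ℓ) λ r₁ → Σ (Fin ℓ) λ r₂ →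
    CycConsec ℓ p r₁ × CycConsec ℓ p r₂ × r₁ ≢ r₂ × ¬ CycConsec ℓ r₁ r₂
  cycConsec-twoNeighbours 4≤ℓ@(s≤s (s≤s (s≤s _))) p =
    rotate (toℕ p) one , rotate (toℕ p) last ,
    fromZero (inj₁ (inj₁ refl)) , fromZero (inj₂ (inj₁ (refl , cong suc (toℕ-fromℕ m)))) ,
    (λ e → one≢last (cong toℕ (rotate-injective p e))) ,
    ¬cycConsec-one-last 4≤ℓ refl (toℕ-fromℕ m) ∘ cycConsec-unrotate p
    where
    one last : Fin ℓ
    one = fsuc fzero
    last = fromℕ m
    one≢last : 1 ≢ toℕ last
    one≢last e with trans e (toℕ-fromℕ m)
    ... | ()
    fromZero : ∀ {r} → CycConsec ℓ fzero r → CycConsec ℓ p (rotate (toℕ p) r)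
    fromZero {r} c =
      subst (λ z → CycConsec ℓ z (rotate (toℕ p) r)) (rotate-zero p) (cycConsec-rotate (toℕ p) c)

  cycConsec-gap : ∀ {i j} → 0 < toℕ i → suc (toℕ i) < toℕ j → ¬ CycConsec ℓ i j
  cycConsec-gap 0<i i+1<j (inj₁ (inj₁ e))       = <-irrefl e i+1<j
  cycConsec-gap 0<i i+1<j (inj₁ (inj₂ e))       = <-asym (<-trans (n<1+n _) i+1<j) (subst (_ <_) e (n<1+n _))
  cycConsec-gap 0<i i+1<j (inj₂ (inj₁ (i≡0 , _))) = <-irrefl (sym i≡0) 0<i
  cycConsec-gap 0<i i+1<j (inj₂ (inj₂ (j≡0 , _))) = n≮0 (subst (suc (toℕ _) <_) j≡0 i+1<j)

open CyclicPositions

module InducedFacts {V : Set} (_~_ : V → V → Set) where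
  open Induced _~_

  ClawCentre : V → Set
  ClawCentre c = Σ V λ a → Σ V λ b → Σ V λ d →
    (c ~ a × c ~ b × c ~ d) × (a ≢ b × a ≢ d × b ≢ d) × (¬ a ~ b × ¬ a ~ d × ¬ b ~ d)

  module ChordlessPathEnds {j} {p : Fin (3 + j) → V} (cp : ChordlessPath (2 + j) p) where
    second penultimate : Fin (3 + j)
    second      = fsuc fzero
    penultimate = inject₁ (fromℕ (suc j))

    toℕ-penultimate : toℕ penultimate ≡ suc j
    toℕ-penultimate = trans (toℕ-inject₁ (fromℕ (suc j))) (toℕ-fromℕ (suc j))

    second-internal : Internal (2 + j) second
    second-internal = s≤s z≤n , s≤s (s≤s z≤n)

    penultimate-internal : Internal (2 + j) penultimate
    penultimate-internal = subst (λ t → 0 < t × t < 2 + j) (sym toℕ-penultimate) (s≤s z≤n , ≤-refl)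

    first-edge : p fzero ~ p second
    first-edge = Equivalence.from (proj₂ cp fzero second) (inj₁ refl)

    last-edge : p (fromℕ (2 + j)) ~ p penultimate
    last-edge = Equivalence.from (proj₂ cp (fromℕ (2 + j)) penultimate)
      (inj₂ (trans (cong suc toℕ-penultimate) (sym (toℕ-fromℕ (2 + j)))))

    ends-distinct : p fzero ≢ p (fromℕ (2 + j))
    ends-distinct e with proj₁ cp e
    ... | ()

    ends-nonadjacent : ¬ p fzero ~ p (fromℕ (2 + j))
    ends-nonadjacent a with Equivalence.to (proj₂ cp fzero (fromℕ (2 + j))) a
    ... | inj₁ e with trans e (toℕ-fromℕ (2 + j))
    ...   | ()
    ends-nonadjacent a | inj₂ ()

  theta-ends : HasTheta → Σ V λ a → Σ V λ b → a ≢ b × ¬ a ~ b × ClawCentre a × ClawCentre b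
  theta-ends (a , b , suc (suc j₁) , suc (suc j₂) , suc (suc j₃) , p₁ , p₂ , p₃ ,
              (s≤s (s≤s _) , s≤s (s≤s _) , s≤s (s≤s _)) ,
              (c₁ , c₂ , c₃) , (p₁0 , p₂0 , p₃0) , (p₁m , p₂m , p₃m) , (s₁₂ , s₁₃ , s₂₃)) =
    a , b ,
    subst₂ _≢_ p₁0 p₁m P₁.ends-distinct ,
    subst₂ (λ u w → ¬ u ~ w) p₁0 p₁m P₁.ends-nonadjacent ,
    claw (subst (_~ _) p₁0 P₁.first-edge) (subst (_~ _) p₂0 P₂.first-edge) (subst (_~ _) p₃0 P₃.first-edge)
         (s₁₂ _ _ P₁.second-internal P₂.second-internal)
         (s₁₃ _ _ P₁.second-internal P₃.second-internal)
         (s₂₃ _ _ P₂.second-internal P₃.second-internal) ,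
    claw (subst (_~ _) p₁m P₁.last-edge) (subst (_~ _) p₂m P₂.last-edge) (subst (_~ _) p₃m P₃.last-edge)
         (s₁₂ _ _ P₁.penultimate-internal P₂.penultimate-internal)
         (s₁₃ _ _ P₁.penultimate-internal P₃.penultimate-internal)
         (s₂₃ _ _ P₂.penultimate-internal P₃.penultimate-internal)
    where
    module P₁ = ChordlessPathEnds c₁
    module P₂ = ChordlessPathEnds c₂
    module P₃ = ChordlessPathEnds c₃
    claw : ∀ {c x y z} → c ~ x → c ~ y → c ~ z →
           x ≢ y × ¬ x ~ y → x ≢ z × ¬ x ~ z → y ≢ z × ¬ y ~ z → ClawCentre c
    claw cx cy cz (x≢y , x≁y) (x≢z , x≁z) (y≢z , y≁z) =
      _ , _ , _ , (cx , cy , cz) , (x≢y , x≢z , y≢z) , (x≁y , x≁z , y≁z)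

  module _ {ℓ} {h : Fin ℓ → V} (H : IsHole ℓ h) where
    hole-adj : ∀ {i j} → CycConsec ℓ i j → h i ~ h j
    hole-adj {i} {j} = Equivalence.from (proj₂ (proj₂ H) i j)

    hole-consec : ∀ {i j} → h i ~ h j → CycConsec ℓ i j
    hole-consec {i} {j} = Equivalence.to (proj₂ (proj₂ H) i j)

    hole-injective : Injective _≡_ _≡_ h
    hole-injective = proj₁ (proj₂ H)

  OnHole : ∀ {ℓ} → (Fin ℓ → V) → V → Set
  OnHole {ℓ} h u = Σ (Fin ℓ) λ r → h r ≡ u

  hole-neighbours : ∀ {ℓ h} → IsHole ℓ h → ∀ p → Σ V λ u → Σ V λ w →
    OnHole h u × OnHole h w × h p ~ u × h p ~ w × u ≢ w × ¬ u ~ w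
  hole-neighbours H@(4≤ℓ@(s≤s _) , _ , _) p with cycConsec-twoNeighbours 4≤ℓ p
  ... | r₁ , r₂ , c₁ , c₂ , r₁≢r₂ , r₁≁r₂ =
    _ , _ , (r₁ , refl) , (r₂ , refl) , hole-adj H c₁ , hole-adj H c₂ ,
    r₁≢r₂ ∘ hole-injective H , r₁≁r₂ ∘ hole-consec H

  hole-noTriangle : ∀ {ℓ h} → IsHole ℓ h → ∀ {a b c} → b ≢ c → h a ~ h b → h a ~ h c → ¬ h b ~ h c
  hole-noTriangle H@(4≤ℓ@(s≤s _) , _ , _) b≢c ab ac bc =
    cycConsec-noTriangle 4≤ℓ b≢c (hole-consec H ab) (hole-consec H ac) (hole-consec H bc)

  hole-rotate : ∀ {m h} → IsHole (suc m) h → ∀ p → IsHole (suc m) (h ∘ rotate (toℕ p))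
  hole-rotate H@(4≤ℓ , _ , _) p =
    4≤ℓ , rotate-injective p ∘ hole-injective H ,
    λ i j → mk⇔ (cycConsec-unrotate p ∘ hole-consec H) (hole-adj H ∘ cycConsec-rotate (toℕ p))

Unique⇒length≤∣p∣ : ∀ {n} {p : Subset n} {xs} → Unique xs → All (_∈ p) xs → length xs ≤ ∣ p ∣
Unique⇒length≤∣p∣ []              []            = z≤n
Unique⇒length≤∣p∣ (x≢xs ∷ unique) (x∈p ∷ xs∈p) =
  ≤-<-trans (Unique⇒length≤∣p∣ unique xs∈p-x) (x∈p⇒∣p-x∣<∣p∣ x∈p)
  where
  xs∈p-x = All.zipWith (λ (y∈p , x≢y) → x∈p∧x≢y⇒x∈p-y y∈p (x≢y ∘ sym)) (xs∈p , x≢xs)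

module EdgeFacts (R : Graph) where
  open GraphNotions R

  Adj-sym : ∀ {u v} → Adj u v → Adj v u
  Adj-sym {u} {v} = trans (adj-sym v u)

  Adj-irrefl : ∀ {u v} → Adj u v → u ≢ v
  Adj-irrefl {u} uu refl with trans (sym uu) (adj-irrefl u)
  ... | ()

  edge-adj : ∀ e → Adj (src e) (tgt e)
  edge-adj e = Equivalence.to T-≡ (isEdge e)

  edge-ordered : ∀ e → toℕ (src e) < toℕ (tgt e)
  edge-ordered e = <ᵇ⇒< _ _ (ordered e)

  edge-ext : ∀ {e f} → src e ≡ src f → tgt e ≡ tgt f → e ≡ f
  edge-ext {edge s t st s<t} {edge .s .t st′ s<t′} refl refl
    with T-irrelevant st st′ | T-irrelevant s<t s<t′
  ... | refl | refl = refl

  Joins : Edge → Vertex → Vertex → Set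
  Joins e a b = (a ≡ src e × b ≡ tgt e) ⊎ (a ≡ tgt e × b ≡ src e)

  joins : ∀ e {a b} → a ∈ₑ e → b ∈ₑ e → a ≢ b → Joins e a b
  joins e (inj₁ a≡s) (inj₁ b≡s) a≢b = ⊥-elim (a≢b (trans a≡s (sym b≡s)))
  joins e (inj₁ a≡s) (inj₂ b≡t) a≢b = inj₁ (a≡s , b≡t)
  joins e (inj₂ a≡t) (inj₁ b≡s) a≢b = inj₂ (a≡t , b≡s)
  joins e (inj₂ a≡t) (inj₂ b≡t) a≢b = ⊥-elim (a≢b (trans a≡t (sym b≡t)))

  ∈ₑ-adj : ∀ e {a b} → a ∈ₑ e → b ∈ₑ e → a ≢ b → Adj a b
  ∈ₑ-adj e a∈ b∈ a≢b with joins e a∈ b∈ a≢b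
  ... | inj₁ (refl , refl) = edge-adj e
  ... | inj₂ (refl , refl) = Adj-sym (edge-adj e)

  ∈ₑ-ends : ∀ e {a b v} → a ∈ₑ e → b ∈ₑ e → a ≢ b → v ∈ₑ e → v ≡ a ⊎ v ≡ b
  ∈ₑ-ends e a∈ b∈ a≢b v∈ with joins e a∈ b∈ a≢b | v∈
  ... | inj₁ (refl , refl) | inj₁ refl = inj₁ refl
  ... | inj₁ (refl , refl) | inj₂ refl = inj₂ refl
  ... | inj₂ (refl , refl) | inj₁ refl = inj₂ refl
  ... | inj₂ (refl , refl) | inj₂ refl = inj₁ refl

  other-end : ∀ e {v} → v ∈ₑ e → Σ Vertex λ w → w ∈ₑ e × v ≢ w
  other-end e (inj₁ refl) = tgt e , inj₂ refl , Adj-irrefl (edge-adj e)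
  other-end e (inj₂ refl) = src e , inj₁ refl , Adj-irrefl (Adj-sym (edge-adj e))

  edge-unique : ∀ e f {a b} → a ∈ₑ e → b ∈ₑ e → a ∈ₑ f → b ∈ₑ f → a ≢ b → e ≡ f
  edge-unique e f a∈e b∈e a∈f b∈f a≢b with joins e a∈e b∈e a≢b | joins f a∈f b∈f a≢b
  ... | inj₁ (refl , refl) | inj₁ (s , t) = edge-ext s t
  ... | inj₂ (refl , refl) | inj₂ (t , s) = edge-ext s t
  ... | inj₁ (refl , refl) | inj₂ (t , s) =
    ⊥-elim (<-asym (edge-ordered e) (subst₂ (λ u w → toℕ u < toℕ w) (sym s) (sym t) (edge-ordered f)))
  ... | inj₂ (refl , refl) | inj₁ (t , s) =
    ⊥-elim (<-asym (edge-ordered e) (subst₂ (λ u w → toℕ u < toℕ w) (sym t) (sym s) (edge-ordered f)))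

  shared-end-unique : ∀ e f {v w} → e ≢ f → v ∈ₑ e → v ∈ₑ f → w ∈ₑ e → w ∈ₑ f → v ≡ w
  shared-end-unique e f {v} {w} e≢f v∈e v∈f w∈e w∈f with v Fin.≟ w
  ... | yes v≡w = v≡w
  ... | no v≢w = ⊥-elim (e≢f (edge-unique e f v∈e w∈e v∈f w∈f v≢w))

  meet : ∀ e f → SharesEnd e f → Σ Vertex λ v → v ∈ₑ e × v ∈ₑ f
  meet e f (inj₁ s∈f) = src e , inj₁ refl , s∈f
  meet e f (inj₂ t∈f) = tgt e , inj₂ refl , t∈f

  sharesEnd : ∀ e f {v} → v ∈ₑ e → v ∈ₑ f → SharesEnd e f
  sharesEnd e f (inj₁ refl) v∈f = inj₁ v∈f
  sharesEnd e f (inj₂ refl) v∈f = inj₂ v∈f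

  Adj⇒∈N : ∀ {u v} → Adj u v → v ∈ N u
  Adj⇒∈N {u} {v} uv = lookup⇒[]= v (tabulate (adj u)) (trans (lookup∘tabulate (adj u) v) uv)

  2≤deg : ∀ {v a b} → Adj v a → Adj v b → a ≢ b → 2 ≤ deg v
  2≤deg va vb a≢b = Unique⇒length≤∣p∣ ((a≢b ∷ []) ∷ [] ∷ []) (Adj⇒∈N va ∷ Adj⇒∈N vb ∷ [])

  3≤deg : ∀ {v} e f g → v ∈ₑ e → v ∈ₑ f → v ∈ₑ g → e ≢ f → e ≢ g → f ≢ g → 3 ≤ deg v
  3≤deg {v} e f g v∈e v∈f v∈g e≢f e≢g f≢g
    with other-end e v∈e | other-end f v∈f | other-end g v∈g
  ... | a , a∈e , v≢a | b , b∈f , v≢b | c , c∈g , v≢c =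
    Unique⇒length≤∣p∣ ((others≢ e f v∈e v∈f a∈e b∈f v≢a e≢f ∷ others≢ e g v∈e v∈g a∈e c∈g v≢a e≢g ∷ [])
                           ∷ (others≢ f g v∈f v∈g b∈f c∈g v≢b f≢g ∷ []) ∷ [] ∷ [])
      (Adj⇒∈N (∈ₑ-adj e v∈e a∈e v≢a) ∷ Adj⇒∈N (∈ₑ-adj f v∈f b∈f v≢b) ∷ Adj⇒∈N (∈ₑ-adj g v∈g c∈g v≢c) ∷ [])
    where
    others≢ : ∀ e′ f′ {a′ b′} → v ∈ₑ e′ → v ∈ₑ f′ → a′ ∈ₑ e′ → b′ ∈ₑ f′ → v ≢ a′ → e′ ≢ f′ → a′ ≢ b′
    others≢ e′ f′ v∈e′ v∈f′ a∈e′ b∈f′ v≢a′ e′≢f′ refl = e′≢f′ (edge-unique e′ f′ v∈e′ a∈e′ v∈f′ b∈f′ v≢a′)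

  leaf-edge-unique : ∀ {v} e f → deg v ≡ 1 → v ∈ₑ e → v ∈ₑ f → e ≡ f
  leaf-edge-unique e f deg≡1 v∈e v∈f with other-end e v∈e | other-end f v∈f
  ... | a , a∈e , v≢a | b , b∈f , v≢b with a Fin.≟ b
  ...   | yes refl = edge-unique e f v∈e a∈e v∈f b∈f v≢a
  ...   | no a≢b   = ⊥-elim (<-irrefl (sym deg≡1) (2≤deg (∈ₑ-adj e v∈e a∈e v≢a) (∈ₑ-adj f v∈f b∈f v≢b) a≢b))

  record PendantEnds (e : Edge) : Set where
    field
      leaf stem : Vertex
      leaf∈     : leaf ∈ₑ e
      stem∈     : stem ∈ₑ e
      leaf≢stem : leaf ≢ stem
      leaf-deg  : deg leaf ≡ 1

  pendantEnds : ∀ e → Pendant e → PendantEnds e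
  pendantEnds e (inj₁ d) = record
    { leaf = src e ; stem = tgt e ; leaf∈ = inj₁ refl ; stem∈ = inj₂ refl
    ; leaf≢stem = Adj-irrefl (edge-adj e) ; leaf-deg = d }
  pendantEnds e (inj₂ d) = record
    { leaf = tgt e ; stem = src e ; leaf∈ = inj₂ refl ; stem∈ = inj₁ refl
    ; leaf≢stem = Adj-irrefl (Adj-sym (edge-adj e)) ; leaf-deg = d }

  stem-shared : ∀ {e} f (P : PendantEnds e) → e ≢ f → SharesEnd e f → PendantEnds.stem P ∈ₑ f
  stem-shared {e} f P e≢f e∩f with meet e f e∩f
  ... | v , v∈e , v∈f with ∈ₑ-ends e leaf∈ stem∈ leaf≢stem v∈e
    where open PendantEnds P
  ...   | inj₁ refl = ⊥-elim (e≢f (leaf-edge-unique e f (PendantEnds.leaf-deg P) v∈e v∈f))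
  ...   | inj₂ refl = v∈f

  through-shared-end : TriangleFree → ∀ e f g {u} → e ≢ f → u ∈ₑ e → u ∈ₑ f →
                       SharesEnd e g → SharesEnd f g → u ∈ₑ g
  through-shared-end triangleFree e f g {u} e≢f u∈e u∈f e∩g f∩g
    with other-end e u∈e | other-end f u∈f | meet e g e∩g | meet f g f∩g
  ... | a , a∈e , u≢a | b , b∈f , u≢b | v , v∈e , v∈g | w , w∈f , w∈g
    with ∈ₑ-ends e u∈e a∈e u≢a v∈e | ∈ₑ-ends f u∈f b∈f u≢b w∈f
  ...   | inj₁ refl | _         = v∈g
  ...   | inj₂ _    | inj₁ refl = w∈g
  ...   | inj₂ refl | inj₂ refl =
    ⊥-elim (triangleFree u v w (∈ₑ-adj e u∈e v∈e u≢a) (∈ₑ-adj g v∈g w∈g v≢w) (∈ₑ-adj f u∈f w∈f u≢b))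
    where
    v≢w : v ≢ w
    v≢w refl = e≢f (edge-unique e f u∈e v∈e u∈f w∈f u≢a)

module _ {A : Set} where

  LastIs : A → List A → Set
  LastIs v []           = ⊥
  LastIs v (a ∷ [])     = a ≡ v
  LastIs v (a ∷ b ∷ xs) = LastIs v (b ∷ xs)

  lookup-injective : ∀ {xs : List A} → Unique xs → Injective _≡_ _≡_ (lookup xs)
  lookup-injective (x≢xs ∷ u) {fzero}  {fzero}  e = refl
  lookup-injective (x≢xs ∷ u) {fzero}  {fsuc j} e = ⊥-elim (All.lookup x≢xs (∈-lookup j) e)
  lookup-injective (x≢xs ∷ u) {fsuc i} {fzero}  e = ⊥-elim (All.lookup x≢xs (∈-lookup i) (sym e))
  lookup-injective (x≢xs ∷ u) {fsuc i} {fsuc j} e = cong fsuc (lookup-injective u e)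

  lookup-linked : ∀ {_⇝_ : A → A → Set} {xs} → Linked _⇝_ xs →
                  ∀ i j → suc (toℕ i) ≡ toℕ j → lookup xs i ⇝ lookup xs j
  lookup-linked (x⇝y ∷ l) fzero    (fsuc fzero) e = x⇝y
  lookup-linked (x⇝y ∷ l) (fsuc i) (fsuc j)     e = lookup-linked l i j (suc-injective e)
  lookup-linked [-] fzero fzero ()
  lookup-linked (_ ∷ _) fzero fzero ()
  lookup-linked (_ ∷ _) fzero (fsuc (fsuc j)) ()
  lookup-linked (_ ∷ _) (fsuc i) fzero ()

  lookup-last : ∀ {v} xs → LastIs v xs → ∀ i → suc (toℕ i) ≡ length xs → lookup xs i ≡ v
  lookup-last (x ∷ [])     x≡v fzero    _ = x≡v
  lookup-last (x ∷ y ∷ xs) last (fsuc i) e = lookup-last (y ∷ xs) last i (suc-injective e)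

module LoopErasure {A : Set} (_≟_ : DecidableEquality A) (_⇝_ : A → A → Set) where

  record Path (u v : A) : Set where
    constructor path
    field
      rest     : List A
      distinct : Unique (u ∷ rest)
      linked   : Linked _⇝_ (u ∷ rest)
      ends     : LastIs v (u ∷ rest)

  private
    suffix : ∀ {u v} xs → Any (u ≡_) xs → Unique xs → Linked _⇝_ xs → LastIs v xs → Path u v
    suffix (x ∷ xs)     (here refl) d l e             = path xs d l e
    suffix (x ∷ y ∷ xs) (there u∈)  (_ ∷ d) (_ ∷ l) e = suffix (y ∷ xs) u∈ d l e

  walk⇒path : ∀ {u v} → Star _⇝_ u v → Path u v
  walk⇒path ε = path [] ([] ∷ []) [-] refl
  walk⇒path {u} (_◅_ {j = w} u⇝w w⇝*v) with walk⇒path w⇝*v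
  ... | path rest d l e with Any.any? (u ≟_) (w ∷ rest)
  ...   | no u∉ = path (w ∷ rest) (¬Any⇒All¬ (w ∷ rest) u∉ ∷ d) (u⇝w ∷ l) e
  ...   | yes u∈ = suffix (w ∷ rest) u∈ d l e

module Bypass (R : Graph) where
  open GraphNotions R
  open EdgeFacts R

  AdjWithout : Edge → Vertex → Vertex → Set
  AdjWithout e a b = Adj a b × ¬ (a ∈ₑ e × b ∈ₑ e)

  AdjWithout-sym : ∀ {e a b} → AdjWithout e a b → AdjWithout e b a
  AdjWithout-sym (ab , ¬ab∈e) = Adj-sym ab , λ (b∈e , a∈e) → ¬ab∈e (a∈e , b∈e)

  within-edge : ∀ e f {u w} → f ≢ e → u ∈ₑ f → w ∈ₑ f → Star (AdjWithout e) u w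
  within-edge e f {u} {w} f≢e u∈f w∈f with u Fin.≟ w
  ... | yes refl = ε
  ... | no u≢w   = (∈ₑ-adj f u∈f w∈f u≢w , λ (u∈e , w∈e) → f≢e (edge-unique f e u∈f w∈f u∈e w∈e u≢w)) ◅ ε

  CycleEdgesMeetDegree2 : Set
  CycleEdgesMeetDegree2 = ∀ ℓ c i j → IsCycle ℓ c → CycConsec ℓ i j → deg (c i) ≡ 2 ⊎ deg (c j) ≡ 2

  -- a walk of R − e from y to x shortens to a path, which closes up with e to a cycle
  no-bypass : CycleEdgesMeetDegree2 → ∀ e {x y} → x ∈ₑ e → y ∈ₑ e → x ≢ y →
              3 ≤ deg x → 3 ≤ deg y → ¬ Star (AdjWithout e) y x
  no-bypass cycles e {x} {y} x∈e y∈e x≢y 3≤x 3≤y = closes ∘ walk⇒path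
    where
    open LoopErasure Fin._≟_ (AdjWithout e)
    closes : Path y x → ⊥
    closes (path [] _ _ y≡x) = x≢y (sym y≡x)
    closes (path (b ∷ []) _ ((_ , y≁x) ∷ [-]) refl) = y≁x (y∈e , x∈e)
    closes (path (b ∷ b′ ∷ rest) distinct linked ends) =
      ends-of-degree-2 (cycles (length vs) (lookup vs) fzero last cycle (inj₂ (inj₁ (refl , last-is-last))))
      where
      vs = y ∷ b ∷ b′ ∷ rest
      last : Fin (length vs)
      last = fromℕ (2 + length rest)
      last-is-last : suc (toℕ last) ≡ length vs
      last-is-last = cong suc (toℕ-fromℕ _)
      closing : ∀ {i j} → toℕ i ≡ 0 → suc (toℕ j) ≡ length vs → Adj (lookup vs i) (lookup vs j)
      closing {i} {j} i≡0 j≡last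
        rewrite toℕ-injective {i = i} {j = fzero} i≡0 | lookup-last vs ends j j≡last =
        ∈ₑ-adj e y∈e x∈e (x≢y ∘ sym)
      cycle : IsCycle (length vs) (lookup vs)
      cycle = s≤s (s≤s (s≤s z≤n)) , lookup-injective distinct , λ where
        i j (inj₁ (inj₁ i→j)) → proj₁ (lookup-linked linked i j i→j)
        i j (inj₁ (inj₂ j→i)) → Adj-sym (proj₁ (lookup-linked linked j i j→i))
        i j (inj₂ (inj₁ (i≡0 , j≡last))) → closing i≡0 j≡last
        i j (inj₂ (inj₂ (j≡0 , i≡last))) → Adj-sym (closing j≡0 i≡last)
      ends-of-degree-2 : deg y ≡ 2 ⊎ deg (lookup vs last) ≡ 2 → ⊥
      ends-of-degree-2 (inj₁ y≡2) = <-irrefl (sym y≡2) 3≤y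
      ends-of-degree-2 (inj₂ x≡2) =
        <-irrefl (sym (trans (cong deg (sym (lookup-last vs ends last last-is-last))) x≡2)) 3≤x

module PGraph (R : Graph) (k : ℕ) (lab : GraphNotions.Edge R → Fin k) where
  open GraphNotions R
  open EdgeFacts R
  open Bypass R
  open Labelled R k lab
  open Induced PAdj
  open InducedFacts PAdj

  InClique : PVertex → Set
  InClique u = Σ (Fin k) λ i → u ≡ inj₂ i

  line-adj : ∀ e f {v} → v ∈ₑ e → v ∈ₑ f → e ≢ f → PAdj (inj₁ e) (inj₁ f)
  line-adj e f v∈e v∈f e≢f = e≢f , sharesEnd e f v∈e v∈f

  clique-adj : ∀ {u w} → InClique u → InClique w → u ≢ w → PAdj u w
  clique-adj (i , refl) (j , refl) u≢w = u≢w ∘ cong inj₂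

  clique-neighbour-unique : ∀ {i j e} → PAdj (inj₂ i) (inj₁ e) → PAdj (inj₂ j) (inj₁ e) → i ≡ j
  clique-neighbour-unique (_ , ei) (_ , ej) = trans (sym ei) ej

  pendant-neighbours-adjacent : ∀ e f g → Pendant e → PAdj (inj₁ e) (inj₁ f) → PAdj (inj₁ e) (inj₁ g) →
                                f ≢ g → PAdj (inj₁ f) (inj₁ g)
  pendant-neighbours-adjacent e f g pe (e≢f , e∩f) (e≢g , e∩g) =
    line-adj f g (stem-shared f P e≢f e∩f) (stem-shared g P e≢g e∩g)
    where P = pendantEnds e pe

  line-clawFree : ∀ e f g h → PAdj (inj₁ e) (inj₁ f) → PAdj (inj₁ e) (inj₁ g) → PAdj (inj₁ e) (inj₁ h) →
                  f ≢ g → f ≢ h → g ≢ h →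
                  ¬ PAdj (inj₁ f) (inj₁ g) → ¬ PAdj (inj₁ f) (inj₁ h) → ¬ PAdj (inj₁ g) (inj₁ h) → ⊥
  line-clawFree e f g h (_ , e∩f) (_ , e∩g) (_ , e∩h) f≢g f≢h g≢h f≁g f≁h g≁h with e∩f | e∩g | e∩h
  ... | inj₁ s∈f | inj₁ s∈g | _        = f≁g (line-adj f g s∈f s∈g f≢g)
  ... | inj₂ t∈f | inj₂ t∈g | _        = f≁g (line-adj f g t∈f t∈g f≢g)
  ... | inj₁ s∈f | _        | inj₁ s∈h = f≁h (line-adj f h s∈f s∈h f≢h)
  ... | inj₂ t∈f | _        | inj₂ t∈h = f≁h (line-adj f h t∈f t∈h f≢h)
  ... | _        | inj₁ s∈g | inj₁ s∈h = g≁h (line-adj g h s∈g s∈h g≢h)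
  ... | _        | inj₂ t∈g | inj₂ t∈h = g≁h (line-adj g h t∈g t∈h g≢h)

  clawCentre-inClique : ∀ {c} → ClawCentre c → InClique c
  clawCentre-inClique {inj₂ i} _ = i , refl
  clawCentre-inClique {inj₁ e} (a , b , d , (ea , eb , ed) , (a≢b , a≢d , b≢d) , (a≁b , a≁d , b≁d)) =
    ⊥-elim (edge-claw a b d ea eb ed a≢b a≢d b≢d a≁b a≁d b≁d)
    where
    i₁≢ : ∀ {f g} → inj₁ {B = Fin k} f ≢ inj₁ g → f ≢ g
    i₁≢ ne = ne ∘ cong inj₁
    edge-claw : ∀ a b d → PAdj (inj₁ e) a → PAdj (inj₁ e) b → PAdj (inj₁ e) d →
                a ≢ b → a ≢ d → b ≢ d → ¬ PAdj a b → ¬ PAdj a d → ¬ PAdj b d → ⊥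
    edge-claw (inj₁ f) (inj₁ g) (inj₁ h) ef eg eh a≢b a≢d b≢d a≁b a≁d b≁d =
      line-clawFree e f g h ef eg eh (i₁≢ a≢b) (i₁≢ a≢d) (i₁≢ b≢d) a≁b a≁d b≁d
    edge-claw (inj₁ f) (inj₁ g) (inj₂ _) ef eg (pe , _) a≢b _ _ a≁b _ _ =
      a≁b (pendant-neighbours-adjacent e f g pe ef eg (i₁≢ a≢b))
    edge-claw (inj₁ f) (inj₂ _) (inj₁ h) ef (pe , _) eh _ a≢d _ _ a≁d _ =
      a≁d (pendant-neighbours-adjacent e f h pe ef eh (i₁≢ a≢d))
    edge-claw (inj₂ _) (inj₁ g) (inj₁ h) (pe , _) eg eh _ _ b≢d _ _ b≁d =
      b≁d (pendant-neighbours-adjacent e g h pe eg eh (i₁≢ b≢d))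
    edge-claw (inj₂ i) (inj₂ j) d _ _ _ a≢b _ _ a≁b _ _ = a≁b (a≢b ∘ cong inj₂)
    edge-claw (inj₂ i) (inj₁ _) (inj₂ j) _ _ _ _ a≢d _ _ a≁d _ = a≁d (a≢d ∘ cong inj₂)
    edge-claw (inj₁ _) (inj₂ i) (inj₂ j) _ _ _ _ _ b≢d _ _ b≁d = b≁d (b≢d ∘ cong inj₂)

  no-theta : ¬ HasTheta
  no-theta θ with theta-ends θ
  ... | a , b , a≢b , a≁b , centre-a , centre-b =
    a≁b (clique-adj (clawCentre-inClique centre-a) (clawCentre-inClique centre-b) a≢b)

  PendantLabelsUnique : Set
  PendantLabelsUnique = ∀ e → Pendant e → (3 ≤ deg (src e) ⊎ 3 ≤ deg (tgt e)) →
                        ∀ e′ → Pendant e′ → e′ ≢ e → lab e′ ≢ lab e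

  skeleton-triangleFree : IsSkeleton → TriangleFree
  skeleton-triangleFree (_ , _ , triangleFree , _) = triangleFree

  skeleton-cycles : IsSkeleton → CycleEdgesMeetDegree2
  skeleton-cycles (_ , _ , _ , _ , _ , _ , _ , _ , cycles , _) = cycles

  skeleton-pendantLabels : IsSkeleton → PendantLabelsUnique
  skeleton-pendantLabels (_ , _ , _ , _ , _ , _ , _ , _ , _ , _ , _ , unique , _) = unique

  -- the stem of e lies on e, f and g, so it is a branch vertex and (viii) applies
  pendant-label-unique : PendantLabelsUnique → ∀ e f g → Pendant e →
                         PAdj (inj₁ e) (inj₁ f) → PAdj (inj₁ e) (inj₁ g) → f ≢ g →
                         ∀ e′ → Pendant e′ → e′ ≢ e → lab e′ ≢ lab e
  pendant-label-unique unique e f g pe (e≢f , e∩f) (e≢g , e∩g) f≢g = unique e pe stem-branches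
    where
    P = pendantEnds e pe
    open PendantEnds P
    3≤stem : 3 ≤ deg stem
    3≤stem = 3≤deg e f g stem∈ (stem-shared f P e≢f e∩f) (stem-shared g P e≢g e∩g) e≢f e≢g f≢g
    stem-branches : 3 ≤ deg (src e) ⊎ 3 ≤ deg (tgt e)
    stem-branches = Sum.map (λ s → subst (λ v → 3 ≤ deg v) s 3≤stem) (λ t → subst (λ v → 3 ≤ deg v) t 3≤stem)
                            stem∈

  no-diamond : TriangleFree → PendantLabelsUnique → ¬ HasDiamond
  no-diamond triangleFree unique
    (a , b , c , d , (a≢b , a≢c , a≢d , b≢c , b≢d , c≢d) , (ab , ac , ad , bc , bd , c≁d)) =
    diamond a b c d a≢b a≢c a≢d b≢c b≢d c≢d ab ac ad bc bd c≁d
    where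
    with-clique : ∀ i b c d → inj₂ i ≢ b → inj₂ i ≢ c → inj₂ i ≢ d → c ≢ d →
                  PAdj (inj₂ i) b → PAdj (inj₂ i) c → PAdj (inj₂ i) d → PAdj b c → PAdj b d → ¬ PAdj c d → ⊥
    with-clique i (inj₂ j) (inj₁ f) d a≢b _ _ _ _ ac _ bc _ _ =
      a≢b (cong inj₂ (clique-neighbour-unique ac bc))
    with-clique i (inj₂ j) (inj₂ _) (inj₁ f) a≢b _ _ _ _ _ ad _ bd _ =
      a≢b (cong inj₂ (clique-neighbour-unique ad bd))
    with-clique i (inj₂ j) (inj₂ _) (inj₂ _) _ _ _ c≢d _ _ _ _ _ c≁d = c≁d (c≢d ∘ cong inj₂)
    with-clique i (inj₁ e) (inj₂ j) d _ a≢c _ _ ab _ _ bc _ _ =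
      a≢c (cong inj₂ (clique-neighbour-unique ab bc))
    with-clique i (inj₁ e) (inj₁ f) (inj₂ j) _ _ a≢d _ ab _ _ _ bd _ =
      a≢d (cong inj₂ (clique-neighbour-unique ab bd))
    with-clique i (inj₁ e) (inj₁ f) (inj₁ g) _ _ _ c≢d (pe , _) _ _ bc bd c≁d =
      c≁d (pendant-neighbours-adjacent e f g pe bc bd (c≢d ∘ cong inj₁))

    one-clique : ∀ e f i g → e ≢ f → f ≢ g → PAdj (inj₁ e) (inj₁ f) → PAdj (inj₁ e) (inj₂ i) →
                 PAdj (inj₁ e) (inj₁ g) → PAdj (inj₁ f) (inj₂ i) → ⊥
    one-clique e f i g e≢f f≢g ef (pe , ei) eg (pf , fi) =
      pendant-label-unique unique e f g pe ef eg f≢g f pf (e≢f ∘ sym) (trans fi (sym ei))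

    diamond : ∀ a b c d → a ≢ b → a ≢ c → a ≢ d → b ≢ c → b ≢ d → c ≢ d →
              PAdj a b → PAdj a c → PAdj a d → PAdj b c → PAdj b d → ¬ PAdj c d → ⊥
    diamond (inj₂ i) b c d a≢b a≢c a≢d _ _ c≢d ab ac ad bc bd c≁d =
      with-clique i b c d a≢b a≢c a≢d c≢d ab ac ad bc bd c≁d
    diamond (inj₁ e) (inj₂ i) c d a≢b _ _ b≢c b≢d c≢d ab ac ad bc bd c≁d =
      with-clique i (inj₁ e) c d (a≢b ∘ sym) b≢c b≢d c≢d ab bc bd ac ad c≁d
    diamond (inj₁ e) (inj₁ f) (inj₂ i) (inj₂ j) _ _ _ _ _ c≢d _ _ _ _ _ c≁d = c≁d (c≢d ∘ cong inj₂)
    diamond (inj₁ e) (inj₁ f) (inj₂ i) (inj₁ g) a≢b _ _ _ b≢d _ ab ac ad bc _ _ =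
      one-clique e f i g (a≢b ∘ cong inj₁) (b≢d ∘ cong inj₁) ab ac ad bc
    diamond (inj₁ e) (inj₁ f) (inj₁ g) (inj₂ i) a≢b _ _ b≢c _ _ ab ac ad _ bd _ =
      one-clique e f i g (a≢b ∘ cong inj₁) (b≢c ∘ cong inj₁) ab ad ac bd
    diamond (inj₁ e) (inj₁ f) (inj₁ g) (inj₁ h) _ _ _ _ _ c≢d
            (e≢f , e∩f) (_ , e∩g) (_ , e∩h) (_ , f∩g) (_ , f∩h) c≁d with meet e f e∩f
    ... | u , u∈e , u∈f =
      c≁d (line-adj g h (through-shared-end triangleFree e f g e≢f u∈e u∈f e∩g f∩g)
                        (through-shared-end triangleFree e f h e≢f u∈e u∈f e∩h f∩h) (c≢d ∘ cong inj₁))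

  pendant-on-hole : ∀ {ℓ h} → IsHole ℓ h → ∀ {p e} → h p ≡ inj₁ e → Pendant e → OnHole h (inj₂ (lab e))
  pendant-on-hole {h = h} H {p} {e} hp pe with hole-neighbours H p
  ... | u , w , u-on , w-on , pu , pw , u≢w , u≁w =
    neighbour u w u-on w-on (subst (λ z → PAdj z u) hp pu) (subst (λ z → PAdj z w) hp pw) u≢w u≁w
    where
    neighbour : ∀ u w → OnHole h u → OnHole h w → PAdj (inj₁ e) u → PAdj (inj₁ e) w →
                u ≢ w → ¬ PAdj u w → OnHole h (inj₂ (lab e))
    neighbour (inj₂ i) _        (r , hr) _        (_ , ei) _        _   _   = r , trans hr (cong inj₂ (sym ei))
    neighbour (inj₁ _) (inj₂ i) _        (r , hr) _        (_ , ei) _   _   = r , trans hr (cong inj₂ (sym ei))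
    neighbour (inj₁ f) (inj₁ g) _        _        ef       eg       u≢w u≁w =
      ⊥-elim (u≁w (pendant-neighbours-adjacent e f g pe ef eg (u≢w ∘ cong inj₁)))

  clique-on-hole : ∀ {ℓ h} → IsHole ℓ h → ∀ {p i} → h p ≡ inj₂ i →
                   Σ Edge λ e → OnHole h (inj₁ e) × Pendant e × lab e ≡ i
  clique-on-hole {h = h} H {p} {i} hp with hole-neighbours H p
  ... | u , w , u-on , w-on , pu , pw , u≢w , u≁w =
    neighbour u w u-on w-on (subst (λ z → PAdj z u) hp pu) (subst (λ z → PAdj z w) hp pw) u≢w u≁w
    where
    neighbour : ∀ u w → OnHole h u → OnHole h w → PAdj (inj₂ i) u → PAdj (inj₂ i) w →
                u ≢ w → ¬ PAdj u w → Σ Edge λ e → OnHole h (inj₁ e) × Pendant e × lab e ≡ i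
    neighbour (inj₁ f) _        f-on _    (pf , fi) _         _   _   = f , f-on , pf , fi
    neighbour (inj₂ _) (inj₁ g) _    g-on _         (pg , gi) _   _   = g , g-on , pg , gi
    neighbour (inj₂ _) (inj₂ _) _    _    _         _         u≢w u≁w = ⊥-elim (u≁w (u≢w ∘ cong inj₂))

  no-clique-centred-wheel : ∀ {ℓ h} → IsHole ℓ h → ∀ i → (∀ t → h t ≢ inj₂ i) →
    ∀ {t₁ t₂ t₃} → t₁ ≢ t₂ → t₁ ≢ t₃ → t₂ ≢ t₃ →
    PAdj (inj₂ i) (h t₁) → PAdj (inj₂ i) (h t₂) → PAdj (inj₂ i) (h t₃) → ⊥
  no-clique-centred-wheel {h = h} H i i∉h t₁≢t₂ t₁≢t₃ t₂≢t₃ a₁ a₂ a₃ =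
    hole-noTriangle H t₂≢t₃ (hole-clique-adj (in-clique a₁) (in-clique a₂) t₁≢t₂)
                            (hole-clique-adj (in-clique a₁) (in-clique a₃) t₁≢t₃)
                            (hole-clique-adj (in-clique a₂) (in-clique a₃) t₂≢t₃)
    where
    -- a pendant neighbour of i would force the clique vertex i onto the hole
    in-clique : ∀ {t} → PAdj (inj₂ i) (h t) → InClique (h t)
    in-clique {t} it with h t in ht
    ... | inj₂ j = j , refl
    ... | inj₁ e with pendant-on-hole H ht (proj₁ it)
    ...   | r , hr = ⊥-elim (i∉h r (trans hr (cong inj₂ (proj₂ it))))
    hole-clique-adj : ∀ {a b} → InClique (h a) → InClique (h b) → a ≢ b → PAdj (h a) (h b)
    hole-clique-adj ka kb a≢b = clique-adj ka kb (a≢b ∘ hole-injective H)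

  CliqueOrWalk : Edge → ∀ {m} → (Fin (suc m) → PVertex) → Fin (suc m) → Vertex → Fin (suc m) → Set
  CliqueOrWalk e {m} g a u b =
    (Σ (Fin (suc m)) λ t → toℕ a < toℕ t × toℕ t ≤ toℕ b × InClique (g t))
    ⊎ (Σ Edge λ f → g b ≡ inj₁ f × ∀ {w} → w ∈ₑ f → Star (AdjWithout e) u w)

  inClique≢edge : ∀ {u f} → InClique u → u ≢ inj₁ f
  inClique≢edge (i , refl) ()

  arc-walk : ∀ e {m} {g : Fin (suc m) → PVertex} → IsHole (suc m) g → (∀ t → g t ≢ inj₁ e) →
             ∀ a {f u} → g a ≡ inj₁ f → u ∈ₑ f → ∀ d b → toℕ b ≡ toℕ a + d → CliqueOrWalk e g a u b
  arc-walk e {m} {g} G e∉g a {f} {u} ga u∈f = walk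
    where
    off-hole : ∀ {t f′} → g t ≡ inj₁ f′ → f′ ≢ e
    off-hole {t} gt refl = e∉g t gt

    extend : ∀ {b′ b} → suc (toℕ b′) ≡ toℕ b → toℕ a < toℕ b →
             CliqueOrWalk e g a u b′ → CliqueOrWalk e g a u b
    extend b′→b a<b (inj₁ (t , a<t , t≤b′ , kt)) =
      inj₁ (t , a<t , ≤-trans t≤b′ (subst (_ ≤_) b′→b (n≤1+n _)) , kt)
    extend {b′} {b} b′→b a<b (inj₂ (f′ , gb′ , walk)) with g b in gb
    ... | inj₂ i = inj₁ (b , a<b , ≤-refl , i , gb)
    ... | inj₁ f″ with subst₂ PAdj gb′ gb (hole-adj G (inj₁ (inj₁ b′→b)))
    ...   | _ , f′∩f″ with meet f′ f″ f′∩f″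
    ...     | v , v∈f′ , v∈f″ =
      inj₂ (f″ , refl , λ w∈f″ → walk v∈f′ ◅◅ within-edge e f″ (off-hole gb) v∈f″ w∈f″)

    walk : ∀ d b → toℕ b ≡ toℕ a + d → CliqueOrWalk e g a u b
    walk zero b b≡a rewrite toℕ-injective {i = b} {j = a} (trans b≡a (+-identityʳ _)) =
      inj₂ (f , ga , within-edge e f (off-hole ga) u∈f)
    walk (suc d) b b≡a+1+d =
      extend (trans (cong suc (toℕ-fromℕ< a+d<ℓ)) (sym b≡1+a+d))
             (subst (toℕ a <_) (sym b≡1+a+d) (s≤s (m≤m+n _ d)))
             (walk d (fromℕ< a+d<ℓ) (toℕ-fromℕ< a+d<ℓ))
      where
      b≡1+a+d : toℕ b ≡ suc (toℕ a + d)
      b≡1+a+d = trans b≡a+1+d (+-suc (toℕ a) d)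
      a+d<ℓ : toℕ a + d < suc m
      a+d<ℓ = <-trans (subst (toℕ a + d <_) (sym b≡1+a+d) (n<1+n _)) (toℕ<n b)

  module EdgeCentredWheel (cycles : CycleEdgesMeetDegree2) (unique : PendantLabelsUnique)
    {m} {h : Fin (suc m) → PVertex} (H : IsHole (suc m) h) (e : Edge) (e∉h : ∀ t → h t ≢ inj₁ e) where

    off-hole : ∀ {t f} → h t ≡ inj₁ f → e ≢ f
    off-hole {t} ht refl = e∉h t ht

    distinct-on-hole : ∀ {t t′ f g} → t ≢ t′ → h t ≡ inj₁ f → h t′ ≡ inj₁ g → f ≢ g
    distinct-on-hole t≢t′ ht ht′ refl = t≢t′ (hole-injective H (trans ht (sym ht′)))

    hole-line-adj : ∀ {t t′ f g v} → t ≢ t′ → h t ≡ inj₁ f → h t′ ≡ inj₁ g → v ∈ₑ f → v ∈ₑ g →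
                    PAdj (h t) (h t′)
    hole-line-adj {f = f} {g} t≢t′ ht ht′ v∈f v∈g =
      subst₂ PAdj (sym ht) (sym ht′) (line-adj f g v∈f v∈g (distinct-on-hole t≢t′ ht ht′))

    -- each hole neighbour of C passes through y, or through the other end z of C, or is a clique vertex;
    -- two of the latter kinds would be adjacent unless C is pendant, and then its stem is y
    3≤deg-at-hole-edge : ∀ {y pc C} → h pc ≡ inj₁ C → y ∈ₑ C → y ∈ₑ e → 3 ≤ deg y
    3≤deg-at-hole-edge {y} {pc} {C} hc y∈C y∈e with other-end C y∈C | hole-neighbours H pc
    ... | z , z∈C , y≢z | u , w , u-on , w-on , cu , cw , u≢w , u≁w =
      combine u w u≢w u≁w (classify u u-on (subst (λ v → PAdj v u) hc cu))
                          (classify w w-on (subst (λ v → PAdj v w) hc cw))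
      where
      e≢C : e ≢ C
      e≢C = off-hole hc

      Neighbour : PVertex → Set
      Neighbour u = 3 ≤ deg y ⊎ (InClique u × Pendant C) ⊎ (Σ Edge λ f → u ≡ inj₁ f × C ≢ f × e ≢ f × z ∈ₑ f)

      classify : ∀ u → OnHole h u → PAdj (inj₁ C) u → Neighbour u
      classify (inj₂ i) _ (pC , _) = inj₂ (inj₁ ((i , refl) , pC))
      classify (inj₁ f) (r , hr) (C≢f , C∩f) with meet C f C∩f
      ... | v , v∈C , v∈f with ∈ₑ-ends C y∈C z∈C y≢z v∈C
      ...   | inj₁ refl = inj₁ (3≤deg e C f y∈e y∈C v∈f e≢C (off-hole hr) C≢f)
      ...   | inj₂ refl = inj₂ (inj₂ (f , refl , C≢f , off-hole hr , v∈f))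

      pendant-branches : Pendant C → ∀ f → C ≢ f → e ≢ f → z ∈ₑ f → 3 ≤ deg y
      pendant-branches pC f C≢f e≢f z∈f = 3≤deg e C f y∈e y∈C (subst (_∈ₑ f) stem≡y stem∈f) e≢C e≢f C≢f
        where
        P = pendantEnds C pC
        open PendantEnds P
        stem≡y : stem ≡ y
        stem≡y = shared-end-unique C e (e≢C ∘ sym) stem∈ (stem-shared e P (e≢C ∘ sym) (sharesEnd C e y∈C y∈e))
                                   y∈C y∈e
        stem∈f : stem ∈ₑ f
        stem∈f = stem-shared f P C≢f (sharesEnd C f z∈C z∈f)

      combine : ∀ u w → u ≢ w → ¬ PAdj u w → Neighbour u → Neighbour w → 3 ≤ deg y
      combine _ _ _ _ (inj₁ 3≤y) _ = 3≤y
      combine _ _ _ _ (inj₂ _) (inj₁ 3≤y) = 3≤y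
      combine _ _ u≢w u≁w (inj₂ (inj₁ (ku , _))) (inj₂ (inj₁ (kw , _))) = ⊥-elim (u≁w (clique-adj ku kw u≢w))
      combine _ _ _ _ (inj₂ (inj₁ (_ , pC))) (inj₂ (inj₂ (f , _ , C≢f , e≢f , z∈f))) =
        pendant-branches pC f C≢f e≢f z∈f
      combine _ _ _ _ (inj₂ (inj₂ (f , _ , C≢f , e≢f , z∈f))) (inj₂ (inj₁ (_ , pC))) =
        pendant-branches pC f C≢f e≢f z∈f
      combine _ _ u≢w u≁w (inj₂ (inj₂ (f , refl , _ , _ , z∈f))) (inj₂ (inj₂ (g , refl , _ , _ , z∈g))) =
        ⊥-elim (u≁w (line-adj f g z∈f z∈g (u≢w ∘ cong inj₁)))

    -- rotate the hole to start at B and end at A; the clique vertices on it are consecutive, so they lie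
    -- on only one of the two arcs B…C and C…A, and the other arc is a walk of R − e
    bypass : ∀ {x y} → x ∈ₑ e → y ∈ₑ e → x ≢ y → ∀ {pa pb pc A B C} → CycSucc pa pb →
             h pa ≡ inj₁ A → h pb ≡ inj₁ B → h pc ≡ inj₁ C → x ∈ₑ A → x ∈ₑ B → y ∈ₑ C →
             Star (AdjWithout e) y x
    bypass {x} {y} x∈e y∈e x≢y {pa} {pb} {pc} {A} {B} {C} pa→pb ha hb hc x∈A x∈B y∈C = arcs first second
      where
      g : Fin (suc m) → PVertex
      g = h ∘ rotate (toℕ pb)
      G : IsHole (suc m) g
      G = hole-rotate H pb
      e∉g : ∀ t → g t ≢ inj₁ e
      e∉g t = e∉h (rotate (toℕ pb) t)
      c : Fin (suc m)
      c = unrotate pb pc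
      gc : g c ≡ inj₁ C
      gc = trans (cong h (rotate-unrotate pb pc)) hc
      ga : g (fromℕ m) ≡ inj₁ A
      ga = trans (cong h (rotate-last pa→pb)) ha
      c≤m : toℕ c ≤ m
      c≤m = <⇒≤pred (toℕ<n c)
      first : CliqueOrWalk e g fzero x c
      first = arc-walk e G e∉g fzero (trans (cong h (rotate-zero pb)) hb) x∈B (toℕ c) c refl
      second : CliqueOrWalk e g c y (fromℕ m)
      second = arc-walk e G e∉g c gc y∈C (m ∸ toℕ c) (fromℕ m) (trans (toℕ-fromℕ m) (sym (m+[n∸m]≡n c≤m)))
      arcs : CliqueOrWalk e g fzero x c → CliqueOrWalk e g c y (fromℕ m) → Star (AdjWithout e) y x
      arcs (inj₂ (f , gc′ , walk)) _ with inj₁-injective (trans (sym gc) gc′)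
      ... | refl = Star.reverse (AdjWithout-sym {e}) (walk y∈C)
      arcs _ (inj₂ (f , ga′ , walk)) with inj₁-injective (trans (sym ga) ga′)
      ... | refl = walk x∈A
      arcs (inj₁ (t₁ , 0<t₁ , t₁≤c , k₁)) (inj₁ (t₂ , c<t₂ , _ , k₂)) =
        ⊥-elim (cycConsec-gap 0<t₁ (≤-<-trans t₁<c c<t₂)
                 (hole-consec G (clique-adj k₁ k₂ (<⇒≢ t₁<t₂ ∘ cong toℕ ∘ hole-injective G))))
        where
        t₁<c : toℕ t₁ < toℕ c
        t₁<c = ≤∧≢⇒< t₁≤c λ t₁≡c → inClique≢edge k₁ (trans (cong g (toℕ-injective t₁≡c)) gc)
        t₁<t₂ : toℕ t₁ < toℕ t₂
        t₁<t₂ = <-trans t₁<c c<t₂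

    two-at-one-end : ∀ {x y} → x ∈ₑ e → y ∈ₑ e → x ≢ y → ∀ {pa pb pc A B C} → pa ≢ pb →
                     h pa ≡ inj₁ A → h pb ≡ inj₁ B → h pc ≡ inj₁ C → x ∈ₑ A → x ∈ₑ B → y ∈ₑ C → ⊥
    two-at-one-end {x} {y} x∈e y∈e x≢y {pa} {pb} {pc} {A} {B} pa≢pb ha hb hc x∈A x∈B y∈C =
      no-bypass cycles e x∈e y∈e x≢y 3≤x (3≤deg-at-hole-edge hc y∈C y∈e)
        (around (Equivalence.to cycConsec⇔succ (hole-consec H (hole-line-adj pa≢pb ha hb x∈A x∈B))))
      where
      3≤x : 3 ≤ deg x
      3≤x = 3≤deg e A B x∈e x∈A x∈B (off-hole ha) (off-hole hb) (distinct-on-hole pa≢pb ha hb)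
      around : CycSucc pa pb ⊎ CycSucc pb pa → Star (AdjWithout e) y x
      around (inj₁ pa→pb) = bypass x∈e y∈e x≢y pa→pb ha hb hc x∈A x∈B y∈C
      around (inj₂ pb→pa) = bypass x∈e y∈e x≢y pb→pa hb ha hc x∈B x∈A y∈C

    -- the clique vertex lab e lies on the hole, so it has a hole neighbour e′ ≠ e that is also a pendant
    -- edge labelled lab e
    pendant-centre : Pendant e → ∀ {tf tg tk f g} → tf ≢ tg → h tf ≡ inj₁ f → h tg ≡ inj₁ g →
                     h tk ≡ inj₂ (lab e) → SharesEnd e f → SharesEnd e g → ⊥
    pendant-centre pe {f = f} {g} tf≢tg hf hg hk e∩f e∩g with clique-on-hole H hk
    ... | e′ , (r , hr) , pe′ , e′-label =
      pendant-label-unique unique e f g pe (off-hole hf , e∩f) (off-hole hg , e∩g)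
        (distinct-on-hole tf≢tg hf hg) e′ pe′ (off-hole hr ∘ sym) e′-label

    EdgeNeighbour : Fin (suc m) → Set
    EdgeNeighbour t = (Σ Edge λ f → h t ≡ inj₁ f × SharesEnd e f) ⊎ (h t ≡ inj₂ (lab e) × Pendant e)

    edgeNeighbour : ∀ t → PAdj (inj₁ e) (h t) → EdgeNeighbour t
    edgeNeighbour t et with h t
    ... | inj₁ f = inj₁ (f , refl , proj₂ et)
    ... | inj₂ i = inj₂ (cong inj₂ (sym (proj₂ et)) , proj₁ et)

    ends-distinct : src e ≢ tgt e
    ends-distinct = Adj-irrefl (edge-adj e)

    ends-distinct′ : tgt e ≢ src e
    ends-distinct′ = ends-distinct ∘ sym

    concurrent-hole-edges : ∀ {t₁ t₂ t₃ f₁ f₂ f₃ v} → t₁ ≢ t₂ → t₁ ≢ t₃ → t₂ ≢ t₃ →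
                            h t₁ ≡ inj₁ f₁ → h t₂ ≡ inj₁ f₂ → h t₃ ≡ inj₁ f₃ → v ∈ₑ f₁ → v ∈ₑ f₂ → v ∈ₑ f₃ → ⊥
    concurrent-hole-edges t₁≢t₂ t₁≢t₃ t₂≢t₃ h₁ h₂ h₃ v∈f₁ v∈f₂ v∈f₃ =
      hole-noTriangle H t₂≢t₃ (hole-line-adj t₁≢t₂ h₁ h₂ v∈f₁ v∈f₂) (hole-line-adj t₁≢t₃ h₁ h₃ v∈f₁ v∈f₃)
                              (hole-line-adj t₂≢t₃ h₂ h₃ v∈f₂ v∈f₃)

    three-hole-edges : ∀ {t₁ t₂ t₃ f₁ f₂ f₃} → t₁ ≢ t₂ → t₁ ≢ t₃ → t₂ ≢ t₃ →
                       h t₁ ≡ inj₁ f₁ → h t₂ ≡ inj₁ f₂ → h t₃ ≡ inj₁ f₃ →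
                       SharesEnd e f₁ → SharesEnd e f₂ → SharesEnd e f₃ → ⊥
    three-hole-edges t₁≢t₂ t₁≢t₃ t₂≢t₃ h₁ h₂ h₃ s₁ s₂ s₃ with s₁ | s₂ | s₃
    ... | inj₁ a | inj₁ b | inj₁ c = concurrent-hole-edges t₁≢t₂ t₁≢t₃ t₂≢t₃ h₁ h₂ h₃ a b c
    ... | inj₂ a | inj₂ b | inj₂ c = concurrent-hole-edges t₁≢t₂ t₁≢t₃ t₂≢t₃ h₁ h₂ h₃ a b c
    ... | inj₁ a | inj₁ b | inj₂ c = two-at-one-end (inj₁ refl) (inj₂ refl) ends-distinct t₁≢t₂ h₁ h₂ h₃ a b c
    ... | inj₁ a | inj₂ b | inj₁ c = two-at-one-end (inj₁ refl) (inj₂ refl) ends-distinct t₁≢t₃ h₁ h₃ h₂ a c b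
    ... | inj₂ a | inj₁ b | inj₁ c = two-at-one-end (inj₁ refl) (inj₂ refl) ends-distinct t₂≢t₃ h₂ h₃ h₁ b c a
    ... | inj₁ a | inj₂ b | inj₂ c = two-at-one-end (inj₂ refl) (inj₁ refl) ends-distinct′ t₂≢t₃ h₂ h₃ h₁ b c a
    ... | inj₂ a | inj₁ b | inj₂ c = two-at-one-end (inj₂ refl) (inj₁ refl) ends-distinct′ t₁≢t₃ h₁ h₃ h₂ a c b
    ... | inj₂ a | inj₂ b | inj₁ c = two-at-one-end (inj₂ refl) (inj₁ refl) ends-distinct′ t₁≢t₂ h₁ h₂ h₃ a b c

    no-edge-centred-wheel : ∀ {t₁ t₂ t₃} → t₁ ≢ t₂ → t₁ ≢ t₃ → t₂ ≢ t₃ →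
      PAdj (inj₁ e) (h t₁) → PAdj (inj₁ e) (h t₂) → PAdj (inj₁ e) (h t₃) → ⊥
    no-edge-centred-wheel {t₁} {t₂} {t₃} t₁≢t₂ t₁≢t₃ t₂≢t₃ a₁ a₂ a₃ =
      neighbours (edgeNeighbour t₁ a₁) (edgeNeighbour t₂ a₂) (edgeNeighbour t₃ a₃)
      where
      same-clique : ∀ {t t′} → t ≢ t′ → h t ≡ inj₂ (lab e) → h t′ ≡ inj₂ (lab e) → ⊥
      same-clique t≢t′ ht ht′ = t≢t′ (hole-injective H (trans ht (sym ht′)))
      neighbours : EdgeNeighbour t₁ → EdgeNeighbour t₂ → EdgeNeighbour t₃ → ⊥
      neighbours (inj₂ (k₁ , _)) (inj₂ (k₂ , _)) _ = same-clique t₁≢t₂ k₁ k₂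
      neighbours (inj₂ (k₁ , _)) _ (inj₂ (k₃ , _)) = same-clique t₁≢t₃ k₁ k₃
      neighbours _ (inj₂ (k₂ , _)) (inj₂ (k₃ , _)) = same-clique t₂≢t₃ k₂ k₃
      neighbours (inj₁ (_ , h₁ , s₁)) (inj₁ (_ , h₂ , s₂)) (inj₂ (k , pe)) =
        pendant-centre pe t₁≢t₂ h₁ h₂ k s₁ s₂
      neighbours (inj₁ (_ , h₁ , s₁)) (inj₂ (k , pe)) (inj₁ (_ , h₃ , s₃)) =
        pendant-centre pe t₁≢t₃ h₁ h₃ k s₁ s₃
      neighbours (inj₂ (k , pe)) (inj₁ (_ , h₂ , s₂)) (inj₁ (_ , h₃ , s₃)) =
        pendant-centre pe t₂≢t₃ h₂ h₃ k s₂ s₃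
      neighbours (inj₁ (_ , h₁ , s₁)) (inj₁ (_ , h₂ , s₂)) (inj₁ (_ , h₃ , s₃)) =
        three-hole-edges t₁≢t₂ t₁≢t₃ t₂≢t₃ h₁ h₂ h₃ s₁ s₂ s₃

  no-wheel : CycleEdgesMeetDegree2 → PendantLabelsUnique → ¬ HasWheel
  no-wheel cycles unique
    (_ , h , v , H@(s≤s _ , _) , v∉h , t₁ , t₂ , t₃ , (t₁≢t₂ , t₁≢t₃ , t₂≢t₃) , (a₁ , a₂ , a₃)) =
    centre v v∉h a₁ a₂ a₃
    where
    centre : ∀ v → (∀ t → h t ≢ v) → PAdj v (h t₁) → PAdj v (h t₂) → PAdj v (h t₃) → ⊥
    centre (inj₁ e) e∉h = EdgeCentredWheel.no-edge-centred-wheel cycles unique H e e∉h t₁≢t₂ t₁≢t₃ t₂≢t₃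
    centre (inj₂ i) i∉h = no-clique-centred-wheel H i i∉h t₁≢t₂ t₁≢t₃ t₂≢t₃

lemma4p2 : (R : Graph) (k : ℕ) (lab : GraphNotions.Edge R → Fin k) →
           Labelled.IsSkeleton R k lab →
           ¬ Induced.HasTheta (Labelled.PAdj R k lab)
           × ¬ Induced.HasWheel (Labelled.PAdj R k lab)
           × ¬ Induced.HasDiamond (Labelled.PAdj R k lab)
lemma4p2 R k lab skeleton =
  no-theta ,
  no-wheel (skeleton-cycles skeleton) (skeleton-pendantLabels skeleton) ,
  no-diamond (skeleton-triangleFree skeleton) (skeleton-pendantLabels skeleton)
  where open PGraph R k lab
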